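{- Let $n\geq 2$ and $k$ be positive integers. Then the number of proper $k$-colorings of $D_n$ in which $v_1$ and $v_n$ receive the same color is $k(k-1)^{n-2}$, the number of proper $k$-colorings of $D_n$ in which $v_1$ and $v_n$ receive different colors is $k^{n-1}(k-1)$, and hence $P(D_n;k)=k(k-1)^{n-2}+k^{n-1}(k-1)$.
   Context: $D_n$ is the tournament on vertex set $\{v_1,\ldots,v_n\}$ in which, for $1\leq i<j\leq n$ with $(i,j)\neq(1,n)$, the edge between $v_i$ and $v_j$ is oriented from $v_i$ to $v_j$, and the edge between $v_1$ and $v_n$ is oriented from $v_n$ to $v_1$. A proper $k$-coloring of a digraph $D$ is a map $V(D)\to\{1,\ldots,k\}$ such that each color class induces a subdigraph with no directed cycle; $P(D;k)$ is the number of proper $k$-colorings. -}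

module Defs where

open import Data.Nat using (ℕ; zero; suc; _∸_; _<_; _≤_; s≤s; z≤n)
open import Data.Fin using (Fin; toℕ; fromℕ<; inject₁; fromℕ)
  renaming (zero to fzero; suc to fsuc)
open import Data.Fin.Properties using (_≟_; all?)
open import Data.List using (List; []; _∷_; length; filter; map; concatMap; allFin)
open import Data.Vec.Functional using (Vector) renaming (_∷_ to _∷ᶠ_)
open import Data.Product using (_×_; Σ; _,_)
open import Data.Sum using (_⊎_)
open import Relation.Nullary using (¬_; Dec)
open import Relation.Nullary.Decidable using (_×-dec_; ¬?)
open import Relation.Unary using (Pred; Decidable)
open import Relation.Binary.PropositionalEquality using (_≡_)
open import Function.Definitions using (Injective)
open import Level using (0ℓ)

Digraph : ℕ → Set₁
Digraph n = Fin n → Fin n → Set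

-- The tournament D_n on vertices v_1,…,v_n (v_i is the element of Fin n with toℕ = i-1):
-- for i<j, v_i → v_j, except the pair (v_1,v_n), which is oriented v_n → v_1.
D : (n : ℕ) → Digraph n
D n i j =
  (toℕ i < toℕ j × ¬ (toℕ i ≡ 0 × toℕ j ≡ n ∸ 1))
  ⊎ (toℕ i ≡ n ∸ 1 × toℕ j ≡ 0)

record DirectedCycle {n : ℕ} (G : Digraph n) (S : Fin n → Set) : Set where
  field
    m      : ℕ
    m≥1    : 1 ≤ m
    w      : Fin (suc m) → Fin n
    w-inj  : Injective _≡_ _≡_ w
    w-in-S : ∀ i → S (w i)
    step   : ∀ (i : Fin m) → G (w (inject₁ i)) (w (fsuc i))
    close  : G (w (fromℕ m)) (w fzero)

-- A proper k-coloring: every color class induces an acyclic subdigraph.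
Proper : {n : ℕ} → Digraph n → (k : ℕ) → (Fin n → Fin k) → Set
Proper {n} G k c = ∀ (a : Fin k) → ¬ DirectedCycle G (λ v → c v ≡ a)

allMaps : (n k : ℕ) → List (Fin n → Fin k)
allMaps zero    k = (λ ()) ∷ []
allMaps (suc n) k = concatMap (λ f → map (λ a → a ∷ᶠ f) (allFin k)) (allMaps n k)

count : (n k : ℕ) {P : Pred (Fin n → Fin k) 0ℓ} → Decidable P → ℕ
count n k P? = length (filter P? (allMaps n k))

v₁ : {n : ℕ} → 2 ≤ n → Fin n
v₁ (s≤s _) = fzero

vₙ : {n : ℕ} → 2 ≤ n → Fin n
vₙ {suc n} (s≤s _) = fromℕ n

SameEnds? : {n k : ℕ} (h : 2 ≤ n) {P : Pred (Fin n → Fin k) 0ℓ} → Decidable P →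
            Decidable (λ c → P c × c (v₁ h) ≡ c (vₙ h))
SameEnds? h P? c = P? c ×-dec (c (v₁ h) ≟ c (vₙ h))

DiffEnds? : {n k : ℕ} (h : 2 ≤ n) {P : Pred (Fin n → Fin k) 0ℓ} → Decidable P →
            Decidable (λ c → P c × ¬ (c (v₁ h) ≡ c (vₙ h)))
DiffEnds? h P? c = P? c ×-dec ¬? (c (v₁ h) ≟ c (vₙ h))

-- Write first = v_1, last = v_n and mid j = v_{j+2} for the m middle vertices.
-- Structure of D_n: every directed cycle must use the unique "backward" arc
-- last → first (along forward arcs the labels only increase), and it has at
-- least three vertices (a tournament has no 2-cycles), so it also contains a
-- middle vertex.  Conversely first → mid j → last → first is a triangle.
-- Hence a colouring c is proper iff there is no monochromatic triangle, i.e.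
-- unless c first = c last = c (mid j) for some j.
--
-- Counting: maps Fin (suc n) → Fin k are enumerated by their first value, so
-- a count can be computed colour-of-first-vertex by colour-of-first-vertex,
-- and a predicate that constrains the first coordinate independently of the
-- rest factors as a product.  With c first = a fixed, the proper colourings
-- with equal ends are those avoiding a on the middle vertices and using a on
-- last, which gives (k-1)^m * 1; those with different ends only avoid a on
-- last, which gives k^m * (k-1).  Summing over a and over both cases gives
-- the theorem.
module Submission where

open import Defs
open import Data.Nat using (ℕ; _≤_; _+_; _*_; _^_; _∸_)
open import Data.Fin using (Fin)
open import Data.Product using (_×_)
open import Relation.Unary using (Decidable)
open import Relation.Binary.PropositionalEquality using (_≡_)

open import Data.Bool using (true; false; if_then_else_)
open import Data.Empty using (⊥; ⊥-elim)
open import Data.Fin using (toℕ; inject₁; fromℕ) renaming (zero to fzero; suc to fsuc)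
open import Data.Fin.Properties
  using (_≟_; all?; suc-injective; toℕ-injective; toℕ-fromℕ; toℕ-inject₁-≢; fromℕ≢inject₁)
open import Data.List using (List; []; _∷_; _++_; length; filter; map; concatMap; allFin; tabulate)
open import Data.List.Properties
  using (length-++; filter-++; filter-≐; filter-none; filter-all; map-cong; map-tabulate; length-tabulate)
open import Data.List.Relation.Unary.All using (universal)
open import Data.List.Relation.Unary.All.Properties using (tabulate⁺)
open import Data.Nat using (suc; zero; _<_; s≤s; z≤n)
open import Data.Nat.ListAction using (sum)
open import Data.Nat.Properties
  using (+-identityʳ; +-suc; *-assoc; *-comm; *-identityʳ; *-zeroʳ; *-distribʳ-+;
         m+n∸m≡n; ≤-reflexive; ≤-trans; m≤m+n; +-monoˡ-≤; <⇒≱; <-asym; 0≢1+n;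
         +-commutativeSemigroup)
  renaming (suc-injective to ℕ-suc-injective)
open import Algebra.Properties.CommutativeSemigroup +-commutativeSemigroup using (interchange)
open import Data.Product using (Σ; _,_; proj₁; proj₂)
open import Data.Sum using (_⊎_; inj₁; inj₂)
open import Data.Unit using (tt)
open import Data.Vec.Functional using () renaming (_∷_ to _∷ᶠ_)
open import Function using (_∘_)
open import Function.Definitions using (Injective)
open import Relation.Nullary using (¬_; Dec; yes; no; does)
open import Relation.Nullary.Decidable using (_×-dec_; ¬?)
open import Relation.Unary using (Pred; U; _≐_)
open import Relation.Unary.Properties using (U?)
open import Relation.Binary.PropositionalEquality
  using (refl; sym; trans; cong; cong₂; _≢_; module ≡-Reasoning)
open import Level using (0ℓ)

open ≡-Reasoning

indicator : {B : Set} → Dec B → ℕ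
indicator d = if does d then 1 else 0

module _ {A : Set} where

  countIn : {P : Pred A 0ℓ} → Decidable P → List A → ℕ
  countIn P? xs = length (filter P? xs)

  countIn-∷ : {P : Pred A 0ℓ} (P? : Decidable P) (x : A) (xs : List A) →
              countIn P? (x ∷ xs) ≡ indicator (P? x) + countIn P? xs
  countIn-∷ P? x xs with does (P? x)
  ... | true  = refl
  ... | false = refl

  countIn-++ : {P : Pred A 0ℓ} (P? : Decidable P) (xs ys : List A) →
               countIn P? (xs ++ ys) ≡ countIn P? xs + countIn P? ys
  countIn-++ P? xs ys = trans (cong length (filter-++ P? xs ys)) (length-++ (filter P? xs))

  countIn-cong : {P Q : Pred A 0ℓ} (P? : Decidable P) (Q? : Decidable Q) → P ≐ Q →
                 (xs : List A) → countIn P? xs ≡ countIn Q? xs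
  countIn-cong P? Q? P≐Q xs = cong length (filter-≐ P? Q? P≐Q xs)

  countIn-none : {P : Pred A 0ℓ} (P? : Decidable P) → (∀ x → ¬ P x) →
                 (xs : List A) → countIn P? xs ≡ 0
  countIn-none P? none xs = cong length (filter-none P? (universal none xs))

  countIn-as-sum : {P : Pred A 0ℓ} (P? : Decidable P) (xs : List A) →
                   countIn P? xs ≡ sum (map (indicator ∘ P?) xs)
  countIn-as-sum P? []       = refl
  countIn-as-sum P? (x ∷ xs) = trans (countIn-∷ P? x xs) (cong (indicator (P? x) +_) (countIn-as-sum P? xs))

  countIn-split : {P S : Pred A 0ℓ} (P? : Decidable P) (S? : Decidable S) (xs : List A) →
    countIn P? xs ≡ countIn (λ x → P? x ×-dec S? x) xs + countIn (λ x → P? x ×-dec ¬? (S? x)) xs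
  countIn-split P? S? [] = refl
  countIn-split P? S? (x ∷ xs) with P? x | S? x | countIn-split P? S? xs
  ... | yes _ | yes _ | ih = cong suc ih
  ... | yes _ | no _  | ih = trans (cong suc ih) (sym (+-suc _ _))
  ... | no _  | yes _ | ih = ih
  ... | no _  | no _  | ih = ih

  countIn-complement : {S : Pred A 0ℓ} (S? : Decidable S) (xs : List A) →
                       countIn S? xs + countIn (¬? ∘ S?) xs ≡ length xs
  countIn-complement S? [] = refl
  countIn-complement S? (x ∷ xs) with S? x | countIn-complement S? xs
  ... | yes _ | ih = cong suc ih
  ... | no _  | ih = trans (+-suc _ _) (cong suc ih)

  countIn-const-× : {B : Set} {R : Pred A 0ℓ} (d : Dec B) (R? : Decidable R) (xs : List A) →
                    countIn (λ x → d ×-dec R? x) xs ≡ indicator d * countIn R? xs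
  countIn-const-× (yes b) R? xs =
    trans (countIn-cong _ R? (proj₂ , (b ,_)) xs) (sym (+-identityʳ _))
  countIn-const-× (no ¬b) R? xs = countIn-none _ (λ _ → ¬b ∘ proj₁) xs

countIn-map : {A B : Set} {P : Pred B 0ℓ} (P? : Decidable P) (h : A → B) (xs : List A) →
              countIn P? (map h xs) ≡ countIn (P? ∘ h) xs
countIn-map P? h [] = refl
countIn-map P? h (x ∷ xs) with does (P? (h x))
... | true  = cong suc (countIn-map P? h xs)
... | false = countIn-map P? h xs

module _ {A : Set} where

  sum-map-+ : (f g : A → ℕ) (xs : List A) →
              sum (map (λ x → f x + g x) xs) ≡ sum (map f xs) + sum (map g xs)
  sum-map-+ f g [] = refl
  sum-map-+ f g (x ∷ xs) =
    trans (cong (f x + g x +_) (sum-map-+ f g xs)) (interchange (f x) (g x) _ _)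

  sum-map-*ʳ : (f : A → ℕ) (c : ℕ) (xs : List A) →
               sum (map (λ x → f x * c) xs) ≡ sum (map f xs) * c
  sum-map-*ʳ f c [] = refl
  sum-map-*ʳ f c (x ∷ xs) =
    trans (cong (f x * c +_) (sum-map-*ʳ f c xs)) (sym (*-distribʳ-+ c (f x) _))

  sum-map-const : (c : ℕ) (xs : List A) → sum (map (λ _ → c) xs) ≡ length xs * c
  sum-map-const c []       = refl
  sum-map-const c (x ∷ xs) = cong (c +_) (sum-map-const c xs)

length-allFin : (k : ℕ) → length (allFin k) ≡ k
length-allFin k = length-tabulate (λ i → i)

countIn-≡ : {k : ℕ} (a : Fin k) → countIn (a ≟_) (allFin k) ≡ 1
countIn-≡ {suc k} fzero =
  cong suc (cong length (filter-none (fzero {k} ≟_) {xs = tabulate fsuc} (tabulate⁺ (λ _ ()))))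
countIn-≡ {suc k} (fsuc a) = begin
  countIn (fsuc a ≟_) (tabulate fsuc)          ≡⟨ cong (countIn (fsuc a ≟_)) (sym (map-tabulate (λ i → i) fsuc)) ⟩
  countIn (fsuc a ≟_) (map fsuc (allFin k))    ≡⟨ countIn-map (fsuc a ≟_) fsuc (allFin k) ⟩
  countIn (λ b → fsuc a ≟ fsuc b) (allFin k)   ≡⟨ countIn-cong _ (a ≟_) (suc-injective , cong fsuc) (allFin k) ⟩
  countIn (a ≟_) (allFin k)                    ≡⟨ countIn-≡ a ⟩
  1                                            ∎

countIn-≢ : {k : ℕ} (a : Fin k) → countIn (λ b → ¬? (a ≟ b)) (allFin k) ≡ k ∸ 1
countIn-≢ {k} a = begin
  countIn (λ b → ¬? (a ≟ b)) (allFin k)                               ≡⟨ sym (m+n∸m≡n 1 _) ⟩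
  (1 + countIn (λ b → ¬? (a ≟ b)) (allFin k)) ∸ 1                     ≡⟨ cong (λ x → (x + countIn (λ b → ¬? (a ≟ b)) (allFin k)) ∸ 1) (sym (countIn-≡ a)) ⟩
  (countIn (a ≟_) (allFin k) + countIn (λ b → ¬? (a ≟ b)) (allFin k)) ∸ 1 ≡⟨ cong (_∸ 1) (countIn-complement (a ≟_) (allFin k)) ⟩
  length (allFin k) ∸ 1                                               ≡⟨ cong (_∸ 1) (length-allFin k) ⟩
  k ∸ 1                                                               ∎

countIn-U : (k : ℕ) → countIn U? (allFin k) ≡ k
countIn-U k = trans (cong length (filter-all U? (universal (λ _ → tt) (allFin k)))) (length-allFin k)

count-by-first : (n k : ℕ) {Q : Pred (Fin (suc n) → Fin k) 0ℓ} (Q? : Decidable Q) →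
  count (suc n) k Q? ≡ sum (map (λ a → count n k (λ g → Q? (a ∷ᶠ g))) (allFin k))
count-by-first n k Q? = grid (allMaps n k)
  where
  -- allMaps (suc n) k lists a ∷ᶠ f with f in the outer and a in the inner loop;
  -- the sum runs over a outside, so the proof exchanges the two summations.
  grid : (fs : List (Fin n → Fin k)) →
    countIn Q? (concatMap (λ f → map (_∷ᶠ f) (allFin k)) fs)
      ≡ sum (map (λ a → countIn (λ g → Q? (a ∷ᶠ g)) fs) (allFin k))
  grid [] = sym (trans (sum-map-const 0 (allFin k)) (*-zeroʳ (length (allFin k))))
  grid (f ∷ fs) = begin
    countIn Q? (map (_∷ᶠ f) (allFin k) ++ _)
      ≡⟨ countIn-++ Q? (map (_∷ᶠ f) (allFin k)) _ ⟩
    countIn Q? (map (_∷ᶠ f) (allFin k)) + _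
      ≡⟨ cong₂ _+_ (trans (countIn-map Q? (_∷ᶠ f) (allFin k)) (countIn-as-sum _ (allFin k))) (grid fs) ⟩
    sum (map (λ a → indicator (Q? (a ∷ᶠ f))) (allFin k)) + sum (map (λ a → countIn (λ g → Q? (a ∷ᶠ g)) fs) (allFin k))
      ≡⟨ sym (sum-map-+ _ _ (allFin k)) ⟩
    sum (map (λ a → indicator (Q? (a ∷ᶠ f)) + countIn (λ g → Q? (a ∷ᶠ g)) fs) (allFin k))
      ≡⟨ cong sum (map-cong (λ a → sym (countIn-∷ (λ g → Q? (a ∷ᶠ g)) f fs)) (allFin k)) ⟩
    sum (map (λ a → countIn (λ g → Q? (a ∷ᶠ g)) (f ∷ fs)) (allFin k)) ∎

count-uniform : (n k C : ℕ) {Q : Pred (Fin (suc n) → Fin k) 0ℓ} (Q? : Decidable Q) →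
  (∀ a → count n k (λ g → Q? (a ∷ᶠ g)) ≡ C) → count (suc n) k Q? ≡ k * C
count-uniform n k C Q? each = begin
  count (suc n) k Q?                                         ≡⟨ count-by-first n k Q? ⟩
  sum (map (λ a → count n k (λ g → Q? (a ∷ᶠ g))) (allFin k)) ≡⟨ cong sum (map-cong each (allFin k)) ⟩
  sum (map (λ _ → C) (allFin k))                             ≡⟨ sum-map-const C (allFin k) ⟩
  length (allFin k) * C                                      ≡⟨ cong (_* C) (length-allFin k) ⟩
  k * C                                                      ∎

count-cons : (n k : ℕ) {M : Pred (Fin k) 0ℓ} {R : Pred (Fin n → Fin k) 0ℓ}
  (M? : Decidable M) (R? : Decidable R) →
  count (suc n) k (λ c → M? (c fzero) ×-dec R? (λ i → c (fsuc i)))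
    ≡ countIn M? (allFin k) * count n k R?
count-cons n k M? R? = begin
  count (suc n) k (λ c → M? (c fzero) ×-dec R? (λ i → c (fsuc i)))
    ≡⟨ count-by-first n k _ ⟩
  sum (map (λ a → count n k (λ g → M? a ×-dec R? g)) (allFin k))
    ≡⟨ cong sum (map-cong (λ a → countIn-const-× (M? a) R? (allMaps n k)) (allFin k)) ⟩
  sum (map (λ a → indicator (M? a) * count n k R?) (allFin k))
    ≡⟨ sum-map-*ʳ (indicator ∘ M?) _ (allFin k) ⟩
  sum (map (indicator ∘ M?) (allFin k)) * count n k R?
    ≡⟨ cong (_* count n k R?) (sym (countIn-as-sum M? (allFin k))) ⟩
  countIn M? (allFin k) * count n k R? ∎

InitLast : {k : ℕ} (m : ℕ) → Pred (Fin k) 0ℓ → Pred (Fin k) 0ℓ → Pred (Fin (suc m) → Fin k) 0ℓ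
InitLast m M L f = (∀ (j : Fin m) → M (f (inject₁ j))) × L (f (fromℕ m))

initLast? : {k : ℕ} (m : ℕ) {M L : Pred (Fin k) 0ℓ} → Decidable M → Decidable L →
            Decidable (InitLast m M L)
initLast? m M? L? f = all? (λ j → M? (f (inject₁ j))) ×-dec L? (f (fromℕ m))

count-initLast : (m k : ℕ) {M L : Pred (Fin k) 0ℓ} (M? : Decidable M) (L? : Decidable L)
  (Q? : Decidable (InitLast m M L)) →
  count (suc m) k Q? ≡ countIn M? (allFin k) ^ m * countIn L? (allFin k)
count-initLast zero k M? L? Q? = begin
  count 1 k Q?                                   ≡⟨ countIn-cong Q? _ ((λ q → proj₂ q , tt) , (λ q → (λ ()) , proj₁ q)) (allMaps 1 k) ⟩
  count 1 k (λ c → L? (c fzero) ×-dec U? (λ i → c (fsuc i))) ≡⟨ count-cons 0 k L? U? ⟩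
  countIn L? (allFin k) * 1                      ≡⟨ *-comm _ 1 ⟩
  1 * countIn L? (allFin k)                      ∎
count-initLast (suc m) k {M} {L} M? L? Q? = begin
  count (suc (suc m)) k Q?
    ≡⟨ countIn-cong Q? (λ c → M? (c fzero) ×-dec initLast? m M? L? (λ i → c (fsuc i)))
                    ((λ {f} → split {f}) , (λ {f} → join {f})) (allMaps (suc (suc m)) k) ⟩
  count (suc (suc m)) k (λ c → M? (c fzero) ×-dec initLast? m M? L? (λ i → c (fsuc i)))
    ≡⟨ count-cons (suc m) k M? (initLast? m M? L?) ⟩
  countIn M? (allFin k) * count (suc m) k (initLast? m M? L?)
    ≡⟨ cong (countIn M? (allFin k) *_) (count-initLast m k M? L? (initLast? m M? L?)) ⟩
  countIn M? (allFin k) * (countIn M? (allFin k) ^ m * countIn L? (allFin k))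
    ≡⟨ sym (*-assoc (countIn M? (allFin k)) _ _) ⟩
  countIn M? (allFin k) ^ suc m * countIn L? (allFin k) ∎
  where
  split : ∀ {f} → InitLast (suc m) M L f → M (f fzero) × InitLast m M L (λ i → f (fsuc i))
  split (init , l) = init fzero , (init ∘ fsuc) , l
  join : ∀ {f} → M (f fzero) × InitLast m M L (λ i → f (fsuc i)) → InitLast (suc m) M L f
  join (m₀ , init , l) = (λ { fzero → m₀ ; (fsuc j) → init j }) , l

triangle : {n : ℕ} {G : Digraph n} {S : Fin n → Set} {x y z : Fin n} →
  x ≢ y → x ≢ z → y ≢ z → S x → S y → S z → G x y → G y z → G z x → DirectedCycle G S
triangle {G = G} {S} {x} {y} {z} x≢y x≢z y≢z sx sy sz xy yz zx = record
  { m = 2 ; m≥1 = s≤s z≤n ; w = corner ; w-inj = corner-injective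
  ; w-in-S = corner-in-S ; step = arc ; close = zx }
  where
  corner : Fin 3 → Fin _
  corner fzero               = x
  corner (fsuc fzero)        = y
  corner (fsuc (fsuc fzero)) = z

  corner-injective : Injective _≡_ _≡_ corner
  corner-injective {fzero}               {fzero}               _ = refl
  corner-injective {fsuc fzero}          {fsuc fzero}          _ = refl
  corner-injective {fsuc (fsuc fzero)}   {fsuc (fsuc fzero)}   _ = refl
  corner-injective {fzero}               {fsuc fzero}          e = ⊥-elim (x≢y e)
  corner-injective {fzero}               {fsuc (fsuc fzero)}   e = ⊥-elim (x≢z e)
  corner-injective {fsuc fzero}          {fsuc (fsuc fzero)}   e = ⊥-elim (y≢z e)
  corner-injective {fsuc fzero}          {fzero}               e = ⊥-elim (x≢y (sym e))
  corner-injective {fsuc (fsuc fzero)}   {fzero}               e = ⊥-elim (x≢z (sym e))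
  corner-injective {fsuc (fsuc fzero)}   {fsuc fzero}          e = ⊥-elim (y≢z (sym e))

  corner-in-S : ∀ i → S (corner i)
  corner-in-S fzero               = sx
  corner-in-S (fsuc fzero)        = sy
  corner-in-S (fsuc (fsuc fzero)) = sz

  arc : ∀ (i : Fin 2) → G (corner (inject₁ i)) (corner (fsuc i))
  arc fzero        = xy
  arc (fsuc fzero) = yz

-- The arc v_n → v_1, the only arc of D_n that goes from a larger to a smaller label.
BackArc : (n : ℕ) → Fin n → Fin n → Set
BackArc n x y = toℕ x ≡ n ∸ 1 × toℕ y ≡ 0

walk-climbs-or-wraps : {n : ℕ} (l : ℕ) (w : Fin (suc l) → Fin n) →
  (∀ i → D n (w (inject₁ i)) (w (fsuc i))) →
  Σ (Fin (suc l)) (λ i → Σ (Fin (suc l)) (λ j → BackArc n (w i) (w j)))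
    ⊎ toℕ (w fzero) + l ≤ toℕ (w (fromℕ l))
walk-climbs-or-wraps zero w step = inj₂ (≤-reflexive (+-identityʳ _))
walk-climbs-or-wraps (suc l) w step
  with walk-climbs-or-wraps l (w ∘ fsuc) (step ∘ fsuc) | step fzero
... | inj₁ (i , j , back) | _           = inj₁ (fsuc i , fsuc j , back)
... | inj₂ _              | inj₂ back   = inj₁ (fzero , fsuc fzero , back)
... | inj₂ climbs         | inj₁ (up , _) =
  inj₂ (≤-trans (≤-reflexive (+-suc (toℕ (w fzero)) l)) (≤-trans (+-monoˡ-≤ l up) climbs))

cycle-uses-back-arc : {n : ℕ} {S : Fin n → Set} → DirectedCycle (D n) S →
  Σ (Fin n) (λ x → Σ (Fin n) (λ y → S x × S y × BackArc n x y))
cycle-uses-back-arc record { m = len ; w = w ; w-in-S = in-S ; step = step ; close = close }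
  with walk-climbs-or-wraps len w step | close
... | inj₁ (i , j , back) | _         = w i , w j , in-S i , in-S j , back
... | inj₂ _              | inj₂ back = w (fromℕ len) , w fzero , in-S (fromℕ len) , in-S fzero , back
... | inj₂ climbs | inj₁ (down , _) = ⊥-elim (<⇒≱ down (≤-trans (m≤m+n _ len) climbs))

last-or-inject₁ : {n : ℕ} (i : Fin (suc n)) → i ≡ fromℕ n ⊎ Σ (Fin n) (λ j → inject₁ j ≡ i)
last-or-inject₁ {zero}  fzero    = inj₁ refl
last-or-inject₁ {suc n} fzero    = inj₂ (fzero , refl)
last-or-inject₁ {suc n} (fsuc i) with last-or-inject₁ i
... | inj₁ refl       = inj₁ refl
... | inj₂ (j , refl) = inj₂ (fsuc j , refl)

inject₁<fromℕ : {m : ℕ} (j : Fin m) → toℕ (inject₁ j) < toℕ (fromℕ m)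
inject₁<fromℕ fzero    = s≤s z≤n
inject₁<fromℕ (fsuc j) = s≤s (inject₁<fromℕ j)

module Tournament (m : ℕ) where

  N : ℕ
  N = suc (suc m)

  first last : Fin N
  first = fzero
  last  = fromℕ (suc m)

  mid : Fin m → Fin N
  mid j = fsuc (inject₁ j)

  first→mid : (j : Fin m) → D N first (mid j)
  first→mid j = inj₁ (s≤s z≤n , λ ends → toℕ-inject₁-≢ j (sym (ℕ-suc-injective (proj₂ ends))))

  mid→last : (j : Fin m) → D N (mid j) last
  mid→last j = inj₁ (s≤s (inject₁<fromℕ j) , λ ())

  last→first : D N last first
  last→first = inj₂ (toℕ-fromℕ (suc m) , refl)

  mid≢last : (j : Fin m) → mid j ≢ last
  mid≢last j e = fromℕ≢inject₁ (sym (suc-injective e))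

  -- D_N has no 2-cycles (this needs N ≥ 2: D_1 has a loop).
  D-asym : {x y : Fin N} → D N x y → D N y x → ⊥
  D-asym (inj₁ (up , _))        (inj₁ (down , _))      = <-asym up down
  D-asym (inj₁ (_ , not-back))  (inj₂ (y-last , x-0))  = not-back (x-0 , y-last)
  D-asym (inj₂ (x-last , y-0))  (inj₁ (_ , not-back))  = not-back (y-0 , x-last)
  D-asym (inj₂ (x-last , _))    (inj₂ (_ , x-0))       = 0≢1+n (trans (sym x-0) x-last)

  back-arc-ends : {x y : Fin N} → BackArc N x y → x ≡ last × y ≡ first
  back-arc-ends (x-last , y-0) =
    toℕ-injective (trans x-last (sym (toℕ-fromℕ (suc m)))) , toℕ-injective y-0

  IsEnd : Fin N → Set
  IsEnd v = v ≡ first ⊎ v ≡ last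

  classify : (v : Fin N) → IsEnd v ⊎ Σ (Fin m) (λ j → mid j ≡ v)
  classify fzero    = inj₁ (inj₁ refl)
  classify (fsuc u) with last-or-inject₁ u
  ... | inj₁ refl       = inj₁ (inj₂ refl)
  ... | inj₂ (j , refl) = inj₂ (j , refl)

  three-ends : {x y z : Fin N} → IsEnd x → IsEnd y → IsEnd z → x ≢ y → x ≢ z → y ≢ z → ⊥
  three-ends (inj₁ refl) (inj₁ refl) _           x≢y _   _   = x≢y refl
  three-ends (inj₂ refl) (inj₂ refl) _           x≢y _   _   = x≢y refl
  three-ends (inj₁ refl) (inj₂ refl) (inj₁ refl) _   x≢z _   = x≢z refl
  three-ends (inj₁ refl) (inj₂ refl) (inj₂ refl) _   _   y≢z = y≢z refl
  three-ends (inj₂ refl) (inj₁ refl) (inj₁ refl) _   _   y≢z = y≢z refl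
  three-ends (inj₂ refl) (inj₁ refl) (inj₂ refl) _   x≢z _   = x≢z refl

  some-middle : {S : Fin N → Set} {x y z : Fin N} → S x → S y → S z →
                x ≢ y → x ≢ z → y ≢ z → Σ (Fin m) (λ j → S (mid j))
  some-middle {x = x} {y} {z} sx sy sz x≢y x≢z y≢z with classify x | classify y | classify z
  ... | inj₂ (j , refl) | _ | _ = j , sx
  ... | _ | inj₂ (j , refl) | _ = j , sy
  ... | _ | _ | inj₂ (j , refl) = j , sz
  ... | inj₁ ex | inj₁ ey | inj₁ ez = ⊥-elim (three-ends ex ey ez x≢y x≢z y≢z)

  -- A directed cycle of D_N has at least three vertices, so it meets the middle.
  cycle-has-middle : {S : Fin N → Set} → DirectedCycle (D N) S → Σ (Fin m) (λ j → S (mid j))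
  cycle-has-middle record { m = zero ; m≥1 = () }
  cycle-has-middle record { m = suc zero ; step = step ; close = close } =
    ⊥-elim (D-asym (step fzero) close)
  cycle-has-middle {S} record { m = suc (suc _) ; w-inj = inj ; w-in-S = in-S } =
    some-middle {S = S} (in-S fzero) (in-S (fsuc fzero)) (in-S (fsuc (fsuc fzero)))
      ((λ ()) ∘ inj {fzero} {fsuc fzero})
      ((λ ()) ∘ inj {fzero} {fsuc (fsuc fzero)})
      ((λ ()) ∘ inj {fsuc fzero} {fsuc (fsuc fzero)})

  -- A directed cycle of D_N contains both ends, since it uses the back arc.
  cycle-has-ends : {S : Fin N → Set} → DirectedCycle (D N) S → S first × S last
  cycle-has-ends {S} cyc with cycle-uses-back-arc cyc
  ... | x , y , sx , sy , back with back-arc-ends back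
  ...   | refl , refl = sy , sx

  module _ {k : ℕ} (c : Fin N → Fin k) where

    MonochromaticTriangle : Set
    MonochromaticTriangle = c first ≡ c last × Σ (Fin m) (λ j → c first ≡ c (mid j))

    improper-if-triangle : MonochromaticTriangle → ¬ Proper (D N) k c
    improper-if-triangle (first≡last , j , first≡mid) proper =
      proper (c first)
        (triangle (λ ()) (λ ()) (mid≢last j) refl (sym first≡mid) (sym first≡last)
                  (first→mid j) (mid→last j) last→first)

    proper-if-no-triangle : ¬ MonochromaticTriangle → Proper (D N) k c
    proper-if-no-triangle no-triangle a cyc =
      no-triangle (trans first-a (sym last-a) , j , trans first-a (sym mid-a))
      where
      first-a = proj₁ (cycle-has-ends cyc)
      last-a  = proj₂ (cycle-has-ends cyc)
      j       = proj₁ (cycle-has-middle cyc)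
      mid-a   = proj₂ (cycle-has-middle cyc)

  module _ {k : ℕ} (P? : Decidable (Proper (D N) k)) where

    private
      two≤N : 2 ≤ N
      two≤N = s≤s (s≤s z≤n)

    -- Proper with equal ends: the middle avoids the colour of first, last repeats it.
    SameSpec : Pred (Fin N → Fin k) 0ℓ
    SameSpec c = InitLast m (λ b → ¬ c first ≡ b) (c first ≡_) (λ i → c (fsuc i))

    -- Proper with different ends: only last must avoid the colour of first.
    DiffSpec : Pred (Fin N → Fin k) 0ℓ
    DiffSpec c = InitLast m U (λ b → ¬ c first ≡ b) (λ i → c (fsuc i))

    count-same : count N k (SameEnds? two≤N P?) ≡ k * (k ∸ 1) ^ m
    count-same = begin
      count N k (SameEnds? two≤N P?) ≡⟨ countIn-cong _ same? (to , from) (allMaps N k) ⟩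
      count N k same?               ≡⟨ count-uniform (suc m) k _ same? each ⟩
      k * ((k ∸ 1) ^ m * 1)         ≡⟨ cong (k *_) (*-identityʳ _) ⟩
      k * (k ∸ 1) ^ m               ∎
      where
      same? : Decidable SameSpec
      same? c = initLast? m (λ b → ¬? (c first ≟ b)) (c first ≟_) (λ i → c (fsuc i))
      to : ∀ {c} → Proper (D N) k c × c first ≡ c last → SameSpec c
      to (proper , e) = (λ j first≡mid → improper-if-triangle _ (e , j , first≡mid) proper) , e
      from : ∀ {c} → SameSpec c → Proper (D N) k c × c first ≡ c last
      from (avoid , e) = proper-if-no-triangle _ (λ t → avoid (proj₁ (proj₂ t)) (proj₂ (proj₂ t))) , e
      each : ∀ a → count (suc m) k (λ g → same? (a ∷ᶠ g)) ≡ (k ∸ 1) ^ m * 1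
      each a = trans (count-initLast m k (λ b → ¬? (a ≟ b)) (a ≟_) _)
                     (cong₂ (λ x y → x ^ m * y) (countIn-≢ a) (countIn-≡ a))

    count-diff : count N k (DiffEnds? two≤N P?) ≡ k ^ suc m * (k ∸ 1)
    count-diff = begin
      count N k (DiffEnds? two≤N P?) ≡⟨ countIn-cong _ diff? (to , from) (allMaps N k) ⟩
      count N k diff?               ≡⟨ count-uniform (suc m) k _ diff? each ⟩
      k * (k ^ m * (k ∸ 1))         ≡⟨ sym (*-assoc k _ _) ⟩
      k ^ suc m * (k ∸ 1)           ∎
      where
      diff? : Decidable DiffSpec
      diff? c = initLast? m U? (λ b → ¬? (c first ≟ b)) (λ i → c (fsuc i))
      to : ∀ {c} → Proper (D N) k c × ¬ c first ≡ c last → DiffSpec c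
      to (_ , ne) = (λ _ → tt) , ne
      from : ∀ {c} → DiffSpec c → Proper (D N) k c × ¬ c first ≡ c last
      from (_ , ne) = proper-if-no-triangle _ (ne ∘ proj₁) , ne
      each : ∀ a → count (suc m) k (λ g → diff? (a ∷ᶠ g)) ≡ k ^ m * (k ∸ 1)
      each a = trans (count-initLast m k U? (λ b → ¬? (a ≟ b)) _)
                     (cong₂ (λ x y → x ^ m * y) (countIn-U k) (countIn-≢ a))

mainTheorem11 : (n k : ℕ) → (h : 2 ≤ n) → 1 ≤ k →
    (P? : Decidable (Proper (D n) k)) →
    (count n k (SameEnds? h P?) ≡ k * (k ∸ 1) ^ (n ∸ 2))
    × (count n k (DiffEnds? h P?) ≡ k ^ (n ∸ 1) * (k ∸ 1))
    × (count n k P? ≡ k * (k ∸ 1) ^ (n ∸ 2) + k ^ (n ∸ 1) * (k ∸ 1))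
mainTheorem11 (suc (suc m)) k (s≤s (s≤s z≤n)) _ P? = same , diff , total
  where
  open Tournament m
  same = count-same P?
  diff = count-diff P?
  total = trans (countIn-split P? (λ c → c first ≟ c last) (allMaps N k)) (cong₂ _+_ same diff)
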